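{- Let $G=(V,E)$ be a trivalent $2$-edge-connected graph. For every $A\subseteq V$, $$r^*(\delta(A))=|\delta(A)|-|A|-\omega(V- A)+1.$$ If moreover $A$ is acyclic, then $$r^*(\delta(A))=|A|+\omega(A)-\omega(V- A)+1.$$
   Context: Graphs are finite and undirected and may have parallel edges; trivalent means every vertex has degree $3$. $r^*$ is the rank function of the bond (cographic) matroid of $G$, the dual of the cycle matroid. For $A\subseteq V$, $\delta(A)$ is the set of edges incident to at least one vertex of $A$. $\omega(A)$ is the number of connected components of the induced subgraph $G[A]$, with $\omega(\emptyset)=0$. A vertex subset is acyclic if its induced subgraph contains no cycle; here a cycle may consist of two vertices joined by parallel edges. -}

module Defs where

open import Data.Nat using (ℕ; suc; NonZero)
open import Data.Bool using (Bool; _∧_; _∨_)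
open import Data.Fin using (Fin; _≟_)
open import Data.Fin.Subset using (Subset; _∈_; _⊆_; ∣_∣; ∁; _-_; ⊤)
open import Data.Vec using (lookup; tabulate)
open import Data.Product using (Σ; _×_; _,_; ∃)
open import Data.Sum using (_⊎_)
open import Relation.Nullary using (¬_)
open import Relation.Nullary.Decidable using (⌊_⌋)
open import Relation.Binary.PropositionalEquality using (_≡_)
open import Function.Bundles using (_⇔_)

-- A finite undirected multigraph: vertices Fin n, edges Fin m, edge e has
-- endpoints src e and tgt e (parallel edges allowed; loops allowed).
record Graph : Set where
  field
    n   : ℕ
    m   : ℕ
    src : Fin m → Fin n
    tgt : Fin m → Fin n

module _ (G : Graph) where
  open Graph G

  VSet : Set
  VSet = Subset n

  ESet : Set
  ESet = Subset m

  -- degree (a loop counts twice)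
  degree : Fin n → ℕ
  degree v = ∣ tabulate (λ e → ⌊ src e ≟ v ⌋) ∣ + ∣ tabulate (λ e → ⌊ tgt e ≟ v ⌋) ∣
    where open Data.Nat using (_+_)

  Trivalent : Set
  Trivalent = ∀ v → degree v ≡ 3

  data Reach (Y : ESet) : Fin n → Fin n → Set where
    here : ∀ {u} → Reach Y u u
    step : ∀ {u w v} (e : Fin m) → e ∈ Y →
           (src e ≡ u × tgt e ≡ w) ⊎ (tgt e ≡ u × src e ≡ w) →
           Reach Y w v → Reach Y u v

  Connected : Set
  Connected = NonZero n × (∀ u v → Reach ⊤ u v)

  TwoEdgeConnected : Set
  TwoEdgeConnected = Connected × (∀ e u v → Reach (⊤ - e) u v)

  δ : VSet → ESet
  δ A = tabulate (λ e → lookup A (src e) ∨ lookup A (tgt e))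

  induced : VSet → ESet
  induced A = tabulate (λ e → lookup A (src e) ∧ lookup A (tgt e))

  -- ω(A) ≡ c : G[A] has exactly c connected components, i.e. there is a
  -- labelling of the vertices of A by Fin c, onto, whose fibres are exactly
  -- the connected components of G[A].
  ComponentCount : VSet → ℕ → Set
  ComponentCount A c =
    Σ ((v : Fin n) → v ∈ A → Fin c) λ f →
      (∀ u v (u∈A : u ∈ A) (v∈A : v ∈ A) →
         (f u u∈A ≡ f v v∈A) ⇔ Reach (induced A) u v)
      × (∀ (i : Fin c) → Σ (Fin n) λ v → Σ (v ∈ A) λ v∈A → f v v∈A ≡ i)

  -- an edge set contains no cycle: no edge of it lies on a cycle, i.e. the
  -- ends of each edge e ∈ Y are not joined by a walk in Y - e
  -- (a loop is a cycle; two parallel edges form a cycle)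
  Forest : ESet → Set
  Forest Y = ∀ e → e ∈ Y → ¬ Reach (Y - e) (src e) (tgt e)

  -- independent sets of the cycle matroid M(G) are the forests;
  -- bases are the maximum-size forests
  IsBasis : ESet → Set
  IsBasis B = Forest B × (∀ F → Forest F → ∣ F ∣ Data.Nat.≤ ∣ B ∣)

  -- independent sets of the bond matroid M*(G) = dual of M(G):
  -- sets disjoint from some basis of M(G)
  CoIndependent : ESet → Set
  CoIndependent I = Σ ESet λ B → IsBasis B × (B ⊆ ∁ I)

  CoRank : ESet → ℕ → Set
  CoRank X k =
    (Σ ESet λ I → I ⊆ X × CoIndependent I × ∣ I ∣ ≡ k)
    × (∀ I → I ⊆ X → CoIndependent I → ∣ I ∣ Data.Nat.≤ k)

  AcyclicV : VSet → Set
  AcyclicV A = Forest (induced A)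

module Submission where

-- The bond matroid has rank r*(X) = |X| - r(E) + r(E - X), where r is the rank of the cycle
-- matroid. For X = δ(A), E - X is the edge set of G[V - A], so r(E - X) = |V - A| - ω(V - A),
-- and r(E) = |V| - 1 because G is connected; this is the first formula. Ranks are computed by
-- Kruskal's algorithm: merging component labels edge by edge maintains
-- |forest| + #components = |S|, which yields |S| ≤ |Y| + ω for every edge set Y on S, with
-- equality when Y is a forest. For the second formula, counting edge ends gives
-- |δ(A)| + |E(G[A])| = 3|A| in a trivalent graph, and |E(G[A])| = |A| - ω(A) when G[A] is a
-- forest.

open import Defs

module CographicRankOfCuts where

  open import Data.Nat using (ℕ; zero; suc; pred; _+_; _*_; _≤_; >-nonZero⁻¹)
  open import Data.Nat.Properties
    using (+-*-semiring; +-identityʳ; +-suc; *-identityʳ; *-zeroʳ; *-distribˡ-+; m+[n∸m]≡n; +-cancelʳ-≡;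
           ≤-antisym; ≤-trans; <-irrefl; +-mono-≤; +-monoˡ-≤; +-monoʳ-≤; +-monoˡ-<; +-cancelʳ-≤; module ≤-Reasoning)
  open import Data.Nat.Tactic.RingSolver using (solve-∀)
  open import Algebra.Properties.Semiring.Sum +-*-semiring
    using (sum; sum-syntax; sum-cong-≗; sum-remove; sum-replicate-zero; ∑-distrib-+; ∑-comm; *-distribˡ-sum; *-distribʳ-sum)
  open import Data.Bool using (Bool; true; false; _∧_; _∨_; not)
  open import Data.Fin using (Fin; zero; suc; _≟_; punchIn; punchOut; fromℕ<)
  open import Data.Fin.Properties
    using (injective⇒≤; suc-injective; punchInᵢ≢i; punchOut-cong; punchOut-injective; punchOut-punchIn)
  open import Data.Fin.Subset using (Subset; _∈_; _∉_; _⊆_; ∣_∣; ∁; _∩_; _∪_; _-_; ⁅_⁆; ⊤; ⊥)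
  open import Data.Fin.Subset.Properties
    using (_∈?_; ∈⊤; ∉⊥; ∣⊤∣≡n; ∣⊥∣≡0; ∣p∣≤n; ∣∁p∣≡n∸∣p∣; p⊆q⇒∣p∣≤∣q∣; x∈p⇒∣p-x∣<∣p∣;
           x∈p⇒x∉∁p; x∉p⇒x∈∁p; p∩q⊆p; p∩q⊆q; x∈p∩q⁺; x∈p∩q⁻; ∩-comm; p⊆p∪q; q⊆p∪q; x∈p∪q⁻; ∪-identityʳ;
           x∈⁅x⁆; x∈⁅y⁆⇒x≡y; p─q⊆p; x∈p∧x≢y⇒x∈p-y)
  open import Data.Vec using ([]; _∷_; lookup; tabulate; here; there)
  open import Data.Vec.Properties using (lookup∘tabulate; lookup-map; tabulate-cong; tabulate-∘; lookup⇒[]=; []=⇒lookup)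
  open import Data.List using (List; []; _∷_; allFin)
  open import Data.List.Relation.Unary.Any using () renaming (here to hereₗ; there to thereₗ)
  open import Data.List.Membership.Propositional using () renaming (_∈_ to _∈ₗ_)
  open import Data.List.Membership.Propositional.Properties using (∈-allFin)
  open import Data.Product using (Σ; _×_; _,_; proj₁; proj₂)
  open import Data.Sum as Sum using (_⊎_; inj₁; inj₂; [_,_]′)
  open import Function using (_∘_; id)
  open import Function.Bundles using (_⇔_; mk⇔; Equivalence)
  open import Relation.Nullary using (¬_; Dec; yes; no; contradiction)
  open import Relation.Nullary.Decidable as Dec using (⌊_⌋; dec-true; dec-false; isYes≗does)
  open import Relation.Binary.PropositionalEquality

  -- Counting and finite subsets

  𝟙 : Bool → ℕ
  𝟙 false = 0
  𝟙 true  = 1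

  count : ∀ {k} → (Fin k → Bool) → ℕ
  count p = sum (𝟙 ∘ p)

  count-cong : ∀ {k} {p q : Fin k → Bool} → (∀ i → p i ≡ q i) → count p ≡ count q
  count-cong p≗q = sum-cong-≗ (cong 𝟙 ∘ p≗q)

  ∣p∣≡count : ∀ {k} (p : Subset k) → ∣ p ∣ ≡ count (lookup p)
  ∣p∣≡count []            = refl
  ∣p∣≡count (true  ∷ p) = cong suc (∣p∣≡count p)
  ∣p∣≡count (false ∷ p) = ∣p∣≡count p

  ∣tabulate∣≡count : ∀ {k} (p : Fin k → Bool) → ∣ tabulate p ∣ ≡ count p
  ∣tabulate∣≡count p = trans (∣p∣≡count (tabulate p)) (count-cong (lookup∘tabulate p))

  𝟙-∨+𝟙-∧ : ∀ a b → 𝟙 (a ∨ b) + 𝟙 (a ∧ b) ≡ 𝟙 a + 𝟙 b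
  𝟙-∨+𝟙-∧ false b     = +-identityʳ (𝟙 b)
  𝟙-∨+𝟙-∧ true  false = refl
  𝟙-∨+𝟙-∧ true  true  = refl

  not-∨ : ∀ a b → not (a ∨ b) ≡ not a ∧ not b
  not-∨ false b = refl
  not-∨ true  b = refl

  count-∨+count-∧ : ∀ {k} (p q : Fin k → Bool) →
    count (λ i → p i ∨ q i) + count (λ i → p i ∧ q i) ≡ count p + count q
  count-∨+count-∧ p q = begin
    count (λ i → p i ∨ q i) + count (λ i → p i ∧ q i)
      ≡⟨ sym (∑-distrib-+ (𝟙 ∘ λ i → p i ∨ q i) (𝟙 ∘ λ i → p i ∧ q i)) ⟩
    sum (λ i → 𝟙 (p i ∨ q i) + 𝟙 (p i ∧ q i))
      ≡⟨ sum-cong-≗ (λ i → 𝟙-∨+𝟙-∧ (p i) (q i)) ⟩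
    sum (λ i → 𝟙 (p i) + 𝟙 (q i))
      ≡⟨ ∑-distrib-+ (𝟙 ∘ p) (𝟙 ∘ q) ⟩
    count p + count q  ∎
    where open ≡-Reasoning

  ⌊x≟x⌋ : ∀ {k} (x : Fin k) → ⌊ x ≟ x ⌋ ≡ true
  ⌊x≟x⌋ x = trans (isYes≗does (x ≟ x)) (dec-true (x ≟ x) refl)

  ⌊x≟y⌋-≢ : ∀ {k} {x y : Fin k} → x ≢ y → ⌊ x ≟ y ⌋ ≡ false
  ⌊x≟y⌋-≢ {x = x} {y} x≢y = trans (isYes≗does (x ≟ y)) (dec-false (x ≟ y) x≢y)

  sum-pointMass : ∀ {k} (g : Fin k → ℕ) (x : Fin k) → ∑[ v < k ] (g v * 𝟙 ⌊ x ≟ v ⌋) ≡ g x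
  sum-pointMass {suc k} g x = begin
    ∑[ v < suc k ] (g v * 𝟙 ⌊ x ≟ v ⌋)
      ≡⟨ sum-remove {i = x} (λ v → g v * 𝟙 ⌊ x ≟ v ⌋) ⟩
    g x * 𝟙 ⌊ x ≟ x ⌋ + ∑[ j < k ] (g (punchIn x j) * 𝟙 ⌊ x ≟ punchIn x j ⌋)
      ≡⟨ cong₂ _+_ (cong (λ b → g x * 𝟙 b) (⌊x≟x⌋ x)) (sum-cong-≗ off-x) ⟩
    g x * 1 + ∑[ j < k ] 0
      ≡⟨ cong₂ _+_ (*-identityʳ (g x)) (sum-replicate-zero k) ⟩
    g x + 0
      ≡⟨ +-identityʳ (g x) ⟩
    g x  ∎
    where
    open ≡-Reasoning
    off-x : ∀ j → g (punchIn x j) * 𝟙 ⌊ x ≟ punchIn x j ⌋ ≡ 0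
    off-x j = trans (cong (λ b → g (punchIn x j) * 𝟙 b) (⌊x≟y⌋-≢ (punchInᵢ≢i x j ∘ sym)))
                    (*-zeroʳ (g (punchIn x j)))

  count-∘≡∑-fibres : ∀ {k l} (f : Fin l → Fin k) (a : Fin k → Bool) →
    count (a ∘ f) ≡ ∑[ v < k ] (𝟙 (a v) * count (λ e → ⌊ f e ≟ v ⌋))
  count-∘≡∑-fibres {k} {l} f a = begin
    ∑[ e < l ] 𝟙 (a (f e))
      ≡⟨ sum-cong-≗ (λ e → sym (sum-pointMass (𝟙 ∘ a) (f e))) ⟩
    ∑[ e < l ] ∑[ v < k ] (𝟙 (a v) * 𝟙 ⌊ f e ≟ v ⌋)
      ≡⟨ ∑-comm (λ e v → 𝟙 (a v) * 𝟙 ⌊ f e ≟ v ⌋) ⟩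
    ∑[ v < k ] ∑[ e < l ] (𝟙 (a v) * 𝟙 ⌊ f e ≟ v ⌋)
      ≡⟨ sum-cong-≗ (λ v → sym (*-distribˡ-sum (𝟙 (a v)) (λ e → 𝟙 ⌊ f e ≟ v ⌋))) ⟩
    ∑[ v < k ] (𝟙 (a v) * count (λ e → ⌊ f e ≟ v ⌋))  ∎
    where open ≡-Reasoning

  ∣p∣≡∣p∩q∣+∣p∩∁q∣ : ∀ {k} (p q : Subset k) → ∣ p ∣ ≡ ∣ p ∩ q ∣ + ∣ p ∩ ∁ q ∣
  ∣p∣≡∣p∩q∣+∣p∩∁q∣ []          []          = refl
  ∣p∣≡∣p∩q∣+∣p∩∁q∣ (true  ∷ p) (true  ∷ q) = cong suc (∣p∣≡∣p∩q∣+∣p∩∁q∣ p q)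
  ∣p∣≡∣p∩q∣+∣p∩∁q∣ (true  ∷ p) (false ∷ q) =
    trans (cong suc (∣p∣≡∣p∩q∣+∣p∩∁q∣ p q)) (sym (+-suc ∣ p ∩ q ∣ ∣ p ∩ ∁ q ∣))
  ∣p∣≡∣p∩q∣+∣p∩∁q∣ (false ∷ p) (_     ∷ q) = ∣p∣≡∣p∩q∣+∣p∩∁q∣ p q

  ∣p∪⁅x⁆∣≡1+∣p∣ : ∀ {k} {p : Subset k} {x} → x ∉ p → ∣ p ∪ ⁅ x ⁆ ∣ ≡ suc ∣ p ∣
  ∣p∪⁅x⁆∣≡1+∣p∣ {p = true  ∷ p} {zero}  x∉p = contradiction here x∉p
  ∣p∪⁅x⁆∣≡1+∣p∣ {p = false ∷ p} {zero}  x∉p = cong (suc ∘ ∣_∣) (∪-identityʳ p)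
  ∣p∪⁅x⁆∣≡1+∣p∣ {p = true  ∷ p} {suc x} x∉p = cong suc (∣p∪⁅x⁆∣≡1+∣p∣ (x∉p ∘ there))
  ∣p∪⁅x⁆∣≡1+∣p∣ {p = false ∷ p} {suc x} x∉p = ∣p∪⁅x⁆∣≡1+∣p∣ (x∉p ∘ there)

  ∣p∣+∣∁p∣≡n : ∀ {k} (p : Subset k) → ∣ p ∣ + ∣ ∁ p ∣ ≡ k
  ∣p∣+∣∁p∣≡n p = trans (cong (∣ p ∣ +_) (∣∁p∣≡n∸∣p∣ p)) (m+[n∸m]≡n (∣p∣≤n p))

  x∉p-x : ∀ {k} (p : Subset k) x → x ∉ p - x
  x∉p-x (_ ∷ p) zero    ()
  x∉p-x (_ ∷ p) (suc x) (there x∈p-x) = x∉p-x p x x∈p-x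

  x∈p-y⁻ : ∀ {k} {p : Subset k} {x y} → x ∈ p - y → x ∈ p × x ≢ y
  x∈p-y⁻ {p = p} {y = y} x∈p-y = p─q⊆p p ⁅ y ⁆ x∈p-y , λ { refl → x∉p-x p y x∈p-y }

  ∈-irrelevant : ∀ {k} {p : Subset k} {x} (a b : x ∈ p) → a ≡ b
  ∈-irrelevant here      here      = refl
  ∈-irrelevant (there a) (there b) = cong there (∈-irrelevant a b)

  cong-∈ : ∀ {k} {p : Subset k} {X : Set} (g : ∀ x → x ∈ p → X) {x y} (x∈p : x ∈ p) (y∈p : y ∈ p) →
           x ≡ y → g x x∈p ≡ g y y∈p
  cong-∈ g x∈p y∈p refl = cong (g _) (∈-irrelevant x∈p y∈p)

  index : ∀ {k} (p : Subset k) x → x ∈ p → Fin ∣ p ∣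
  index (true  ∷ p) zero    here        = zero
  index (true  ∷ p) (suc x) (there x∈p) = suc (index p x x∈p)
  index (false ∷ p) (suc x) (there x∈p) = index p x x∈p

  index-injective : ∀ {k} (p : Subset k) {x y} (x∈p : x ∈ p) (y∈p : y ∈ p) → index p x x∈p ≡ index p y y∈p → x ≡ y
  index-injective (true  ∷ p) here        here        _  = refl
  index-injective (true  ∷ p) (there x∈p) (there y∈p) eq = cong suc (index-injective p x∈p y∈p (suc-injective eq))
  index-injective (false ∷ p) (there x∈p) (there y∈p) eq = cong suc (index-injective p x∈p y∈p eq)
  index-injective (true  ∷ p) here        (there _)   ()
  index-injective (true  ∷ p) (there _)   here        ()

  index-surjective : ∀ {k} (p : Subset k) i → Σ (Fin k) λ x → Σ (x ∈ p) λ x∈p → index p x x∈p ≡ i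
  index-surjective (true  ∷ p) zero = zero , here , refl
  index-surjective (true  ∷ p) (suc i) with index-surjective p i
  ... | x , x∈p , eq = suc x , there x∈p , cong suc eq
  index-surjective (false ∷ p) i with index-surjective p i
  ... | x , x∈p , eq = suc x , there x∈p , eq

  ∈-tabulate⁺ : ∀ {k} {f : Fin k → Bool} {x} → f x ≡ true → x ∈ tabulate f
  ∈-tabulate⁺ {f = f} {x} fx = lookup⇒[]= x (tabulate f) (trans (lookup∘tabulate f x) fx)

  ∈-tabulate⁻ : ∀ {k} {f : Fin k → Bool} {x} → x ∈ tabulate f → f x ≡ true
  ∈-tabulate⁻ {f = f} {x} x∈ = trans (sym (lookup∘tabulate f x)) ([]=⇒lookup x∈)

  -- Walks and component labellings

  module Merge {d : ℕ} {i j : Fin (suc d)} (i≢j : i ≢ j) where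

    merge : Fin (suc d) → Fin d
    merge x with x ≟ j
    ... | yes _   = punchOut (i≢j ∘ sym)
    ... | no x≢j = punchOut (x≢j ∘ sym)

    merge-i≡merge-j : merge i ≡ merge j
    merge-i≡merge-j with i ≟ j | j ≟ j
    ... | yes i≡j | _       = contradiction i≡j i≢j
    ... | no _    | yes _   = punchOut-cong j refl
    ... | no _    | no j≢j = contradiction refl j≢j

    merge-≡⁻ : ∀ x y → merge x ≡ merge y → x ≡ y ⊎ ((x ≡ i ⊎ x ≡ j) × (y ≡ i ⊎ y ≡ j))
    merge-≡⁻ x y eq with x ≟ j | y ≟ j
    ... | yes x≡j | yes y≡j = inj₂ (inj₂ x≡j , inj₂ y≡j)
    ... | yes x≡j | no _    = inj₂ (inj₂ x≡j , inj₁ (sym (punchOut-injective {i = j} _ _ eq)))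
    ... | no _    | yes y≡j = inj₂ (inj₁ (punchOut-injective {i = j} _ _ eq) , inj₂ y≡j)
    ... | no _    | no _    = inj₁ (punchOut-injective {i = j} _ _ eq)

    merge-surjective : ∀ k → Σ (Fin (suc d)) λ x → merge x ≡ k
    merge-surjective k = punchIn j k , merge-punchIn
      where
      merge-punchIn : merge (punchIn j k) ≡ k
      merge-punchIn with punchIn j k ≟ j
      ... | yes p≡j = contradiction p≡j (punchInᵢ≢i j k)
      ... | no _    = trans (punchOut-cong j refl) (punchOut-punchIn j)

  module _ (G : Graph) where
    open Graph G

    Links : Fin m → Fin n → Fin n → Set
    Links e u w = (src e ≡ u × tgt e ≡ w) ⊎ (tgt e ≡ u × src e ≡ w)

    EndsIn : VSet G → ESet G → Set
    EndsIn S Y = ∀ {e} → e ∈ Y → src e ∈ S × tgt e ∈ S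

    -- ComponentCount G S c is definitionally Components G S (induced G S) c.
    Components : VSet G → ESet G → ℕ → Set
    Components S Y c =
      Σ ((v : Fin n) → v ∈ S → Fin c) λ f →
        (∀ u v (u∈S : u ∈ S) (v∈S : v ∈ S) → (f u u∈S ≡ f v v∈S) ⇔ Reach G Y u v)
        × (∀ (i : Fin c) → Σ (Fin n) λ v → Σ (v ∈ S) λ v∈S → f v v∈S ≡ i)

  module _ {G : Graph} where
    open Graph G

    links-sym : ∀ {e u w} → Links G e u w → Links G e w u
    links-sym (inj₁ (s≡u , t≡w)) = inj₂ (t≡w , s≡u)
    links-sym (inj₂ (t≡u , s≡w)) = inj₁ (s≡w , t≡u)

    reach-edge : ∀ {Y e u w} → e ∈ Y → Links G e u w → Reach G Y u w
    reach-edge e∈Y l = step _ e∈Y l here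

    reach-trans : ∀ {Y u v w} → Reach G Y u v → Reach G Y v w → Reach G Y u w
    reach-trans here             q = q
    reach-trans (step e e∈Y l p) q = step e e∈Y l (reach-trans p q)

    reach-sym : ∀ {Y u v} → Reach G Y u v → Reach G Y v u
    reach-sym here             = here
    reach-sym (step e e∈Y l p) = reach-trans (reach-sym p) (reach-edge e∈Y (links-sym l))

    reach-lift : ∀ {Y Y'} → (∀ {e} → e ∈ Y → Reach G Y' (src e) (tgt e)) →
                 ∀ {u v} → Reach G Y u v → Reach G Y' u v
    reach-lift h here                               = here
    reach-lift h (step e e∈Y (inj₁ (refl , refl)) p) = reach-trans (h e∈Y) (reach-lift h p)
    reach-lift h (step e e∈Y (inj₂ (refl , refl)) p) = reach-trans (reach-sym (h e∈Y)) (reach-lift h p)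

    reach-mono : ∀ {Y Y'} → Y ⊆ Y' → ∀ {u v} → Reach G Y u v → Reach G Y' u v
    reach-mono Y⊆Y' = reach-lift (λ e∈Y → reach-edge (Y⊆Y' e∈Y) (inj₁ (refl , refl)))

    forest-⊆ : ∀ {F F'} → F ⊆ F' → Forest G F' → Forest G F
    forest-⊆ {F} {F'} F⊆F' forest e e∈F p = forest e (F⊆F' e∈F) (reach-mono shrink p)
      where
      shrink : ∀ {x} → x ∈ F - e → x ∈ F' - e
      shrink x∈F-e with x∈p-y⁻ x∈F-e
      ... | x∈F , x≢e = x∈p∧x≢y⇒x∈p-y (F⊆F' x∈F) x≢e

    ∈-induced⁻ : ∀ {S e} → e ∈ induced G S → src e ∈ S × tgt e ∈ S
    ∈-induced⁻ {S} {e} e∈ with lookup S (src e) in s∈ | lookup S (tgt e) in t∈ | ∈-tabulate⁻ e∈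
    ... | true | true | _ = lookup⇒[]= (src e) S s∈ , lookup⇒[]= (tgt e) S t∈

    link-target∈ : ∀ {S e u w} → src e ∈ S × tgt e ∈ S → Links G e u w → w ∈ S
    link-target∈ (_ , t∈S) (inj₁ (_ , refl)) = t∈S
    link-target∈ (s∈S , _) (inj₂ (_ , refl)) = s∈S

    endsIn-∪⁅e⁆ : ∀ {S Y e} → EndsIn G S Y → src e ∈ S → tgt e ∈ S → EndsIn G S (Y ∪ ⁅ e ⁆)
    endsIn-∪⁅e⁆ {Y = Y} {e} ends s∈S t∈S e'∈Y' with x∈p∪q⁻ Y ⁅ e ⁆ e'∈Y'
    ... | inj₁ e'∈Y   = ends e'∈Y
    ... | inj₂ e'∈⁅e⁆ rewrite x∈⁅y⁆⇒x≡y e e'∈⁅e⁆ = s∈S , t∈S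

    reach⇒label≡ : ∀ {S Y} {X : Set} (g : (v : Fin n) → v ∈ S → X) → EndsIn G S Y →
                   (∀ {e u w} → e ∈ Y → Links G e u w → (u∈S : u ∈ S) (w∈S : w ∈ S) → g u u∈S ≡ g w w∈S) →
                   ∀ {u v} → Reach G Y u v → (u∈S : u ∈ S) (v∈S : v ∈ S) → g u u∈S ≡ g v v∈S
    reach⇒label≡ g ends edge≡ here             u∈S v∈S = cong-∈ g u∈S v∈S refl
    reach⇒label≡ g ends edge≡ (step e e∈Y l p) u∈S v∈S =
      trans (edge≡ e∈Y l u∈S w∈S) (reach⇒label≡ g ends edge≡ p w∈S v∈S)
      where w∈S = link-target∈ (ends e∈Y) l

    components-≤ : ∀ {S Y Y' c d} → Components G S Y c → Components G S Y' d →
                   (∀ {u v} → Reach G Y' u v → Reach G Y u v) → c ≤ d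
    components-≤ (f , f-fibres , f-onto) (g , g-fibres , _) Y'⇒Y = injective⇒≤ ψ-injective
      where
      rep : ∀ i → Fin n
      rep i = proj₁ (f-onto i)
      rep∈S : ∀ i → rep i ∈ _
      rep∈S i = proj₁ (proj₂ (f-onto i))
      ψ : Fin _ → Fin _
      ψ i = g (rep i) (rep∈S i)
      ψ-injective : ∀ {i i'} → ψ i ≡ ψ i' → i ≡ i'
      ψ-injective {i} {i'} eq = begin
        i                      ≡⟨ sym (proj₂ (proj₂ (f-onto i))) ⟩
        f (rep i) (rep∈S i)    ≡⟨ Equivalence.from (f-fibres _ _ (rep∈S i) (rep∈S i'))
                                    (Y'⇒Y (Equivalence.to (g-fibres _ _ (rep∈S i) (rep∈S i')) eq)) ⟩
        f (rep i') (rep∈S i')  ≡⟨ proj₂ (proj₂ (f-onto i')) ⟩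
        i'                     ∎
        where open ≡-Reasoning

    components-cong : ∀ {S Y Y' c} → (∀ {u v} → Reach G Y u v → Reach G Y' u v) →
                      (∀ {u v} → Reach G Y' u v → Reach G Y u v) → Components G S Y c → Components G S Y' c
    components-cong Y⇒Y' Y'⇒Y (f , fibres , onto) =
      f , (λ u v u∈S v∈S → mk⇔ (Y⇒Y' ∘ Equivalence.to (fibres u v u∈S v∈S))
                               (Equivalence.from (fibres u v u∈S v∈S) ∘ Y'⇒Y)) , onto

    reach-⊥ : ∀ {u v} → Reach G ⊥ u v → u ≡ v
    reach-⊥ here                = refl
    reach-⊥ (step e e∈⊥ _ _) = contradiction e∈⊥ ∉⊥

    components-⊥ : ∀ S → Components G S ⊥ ∣ S ∣
    components-⊥ S = index S , fibres , index-surjective S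
      where
      fibres : ∀ u v (u∈S : u ∈ S) (v∈S : v ∈ S) → (index S u u∈S ≡ index S v v∈S) ⇔ Reach G ⊥ u v
      fibres u v u∈S v∈S = mk⇔ (λ eq → subst (Reach G ⊥ u) (index-injective S u∈S v∈S eq) here)
                               (cong-∈ (index S) u∈S v∈S ∘ reach-⊥)

    components-insert : ∀ {S Y d e} → EndsIn G S Y → (s∈S : src e ∈ S) (t∈S : tgt e ∈ S) →
                        ¬ Reach G Y (src e) (tgt e) → Components G S Y (suc d) → Components G S (Y ∪ ⁅ e ⁆) d
    components-insert {S} {Y} {d} {e} ends s∈S t∈S unlinked (f , fibres , onto) = f' , fibres' , onto'
      where
      i = f (src e) s∈S
      j = f (tgt e) t∈S
      open Merge {i = i} {j} (unlinked ∘ Equivalence.to (fibres _ _ s∈S t∈S))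

      f' : (v : Fin n) → v ∈ S → Fin d
      f' v v∈S = merge (f v v∈S)

      Y' = Y ∪ ⁅ e ⁆

      Y⊆Y' : Y ⊆ Y'
      Y⊆Y' = p⊆p∪q ⁅ e ⁆

      e∈Y' : e ∈ Y'
      e∈Y' = q⊆p∪q Y ⁅ e ⁆ (x∈⁅x⁆ e)

      reach-src : ∀ u (u∈S : u ∈ S) → f u u∈S ≡ i ⊎ f u u∈S ≡ j → Reach G Y' u (src e)
      reach-src u u∈S (inj₁ ≡i) = reach-mono Y⊆Y' (Equivalence.to (fibres _ _ u∈S s∈S) ≡i)
      reach-src u u∈S (inj₂ ≡j) = reach-trans (reach-mono Y⊆Y' (Equivalence.to (fibres _ _ u∈S t∈S) ≡j))
                                              (reach-edge e∈Y' (inj₂ (refl , refl)))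

      label≡⇒reach : ∀ u v (u∈S : u ∈ S) (v∈S : v ∈ S) → f' u u∈S ≡ f' v v∈S → Reach G Y' u v
      label≡⇒reach u v u∈S v∈S eq with merge-≡⁻ _ _ eq
      ... | inj₁ same        = reach-mono Y⊆Y' (Equivalence.to (fibres _ _ u∈S v∈S) same)
      ... | inj₂ (u~ , v~) = reach-trans (reach-src u u∈S u~) (reach-sym (reach-src v v∈S v~))

      edge⇒label≡ : ∀ {e' u w} → e' ∈ Y' → Links G e' u w → (u∈S : u ∈ S) (w∈S : w ∈ S) → f' u u∈S ≡ f' w w∈S
      edge⇒label≡ {e'} e'∈Y' l u∈S w∈S with x∈p∪q⁻ Y ⁅ e ⁆ e'∈Y'
      ... | inj₁ e'∈Y = cong merge (Equivalence.from (fibres _ _ u∈S w∈S) (reach-edge e'∈Y l))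
      ... | inj₂ e'∈⁅e⁆ with x∈⁅y⁆⇒x≡y e e'∈⁅e⁆ | l
      ...   | refl | inj₁ (refl , refl) =
                trans (cong merge (cong-∈ f u∈S s∈S refl)) (trans merge-i≡merge-j (cong merge (cong-∈ f t∈S w∈S refl)))
      ...   | refl | inj₂ (refl , refl) =
                trans (cong merge (cong-∈ f u∈S t∈S refl)) (trans (sym merge-i≡merge-j) (cong merge (cong-∈ f s∈S w∈S refl)))

      fibres' : ∀ u v (u∈S : u ∈ S) (v∈S : v ∈ S) → (f' u u∈S ≡ f' v v∈S) ⇔ Reach G Y' u v
      fibres' u v u∈S v∈S =
        mk⇔ (label≡⇒reach u v u∈S v∈S) (λ p → reach⇒label≡ f' (endsIn-∪⁅e⁆ ends s∈S t∈S) edge⇒label≡ p u∈S v∈S)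

      onto' : ∀ k → Σ (Fin n) λ v → Σ (v ∈ S) λ v∈S → f' v v∈S ≡ k
      onto' k with merge-surjective k
      ... | x , merge-x≡k with onto x
      ...   | v , v∈S , fv≡x = v , v∈S , trans (cong merge fv≡x) merge-x≡k

    -- Kruskal's algorithm

    record KruskalState (S : VSet G) : Set where
      field
        edges        : ESet G
        #components  : ℕ
        components   : Components G S edges #components
        edges-within : EndsIn G S edges
        size         : ∣ edges ∣ + #components ≡ ∣ S ∣
    open KruskalState

    initialState : ∀ S → KruskalState S
    initialState S = record
      { edges        = ⊥
      ; #components  = ∣ S ∣
      ; components   = components-⊥ S
      ; edges-within = λ e∈⊥ → contradiction e∈⊥ ∉⊥
      ; size         = cong (_+ ∣ S ∣) (∣⊥∣≡0 m)
      }

    reach? : ∀ {S} (s : KruskalState S) {u v} → u ∈ S → v ∈ S → Dec (Reach G (edges s) u v)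
    reach? s u∈S v∈S with components s
    ... | f , fibres , _ = Dec.map (fibres _ _ u∈S v∈S) (f _ u∈S ≟ f _ v∈S)

    insertEdge : ∀ {S} (s : KruskalState S) {e} → src e ∈ S → tgt e ∈ S →
                 ¬ Reach G (edges s) (src e) (tgt e) → KruskalState S
    insertEdge {S} s {e} s∈S t∈S unlinked = record
      { edges        = edges s ∪ ⁅ e ⁆
      ; #components  = pred (#components s)
      ; components   = components'
      ; edges-within = endsIn-∪⁅e⁆ (edges-within s) s∈S t∈S
      ; size         = size'
      }
      where
      open ≡-Reasoning

      components' : Components G S (edges s ∪ ⁅ e ⁆) (pred (#components s))
      components' with #components s | components s
      ... | zero  | f , _ = contradiction (f _ s∈S) λ ()
      ... | suc d | comps = components-insert (edges-within s) s∈S t∈S unlinked comps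

      size' : ∣ edges s ∪ ⁅ e ⁆ ∣ + pred (#components s) ≡ ∣ S ∣
      size' with #components s | components s | size s
      ... | zero  | f , _ | _    = contradiction (f _ s∈S) λ ()
      ... | suc d | _     | size = begin
        ∣ edges s ∪ ⁅ e ⁆ ∣ + d  ≡⟨ cong (_+ d) (∣p∪⁅x⁆∣≡1+∣p∣ e∉edges) ⟩
        suc ∣ edges s ∣ + d     ≡⟨ sym (+-suc ∣ edges s ∣ d) ⟩
        ∣ edges s ∣ + suc d     ≡⟨ size ⟩
        ∣ S ∣                    ∎
        where
        e∉edges : e ∉ edges s
        e∉edges e∈ = unlinked (reach-edge e∈ (inj₁ (refl , refl)))

    record Extension {S} (s : KruskalState S) (Y : ESet G) (L : List (Fin m)) : Set where
      field
        result   : KruskalState S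
        extends  : edges s ⊆ edges result
        within   : ∀ {e} → e ∈ edges result → e ∈ edges s ⊎ e ∈ Y
        connects : ∀ {e} → e ∈ₗ L → e ∈ Y → Reach G (edges result) (src e) (tgt e)
    open Extension

    extendByEdge : ∀ {S Y} → EndsIn G S Y → (s : KruskalState S) (e : Fin m) → Extension s Y (e ∷ [])
    extendByEdge {Y = Y} ends s e with e ∈? Y
    ... | no e∉Y =
      record { result = s ; extends = id ; within = inj₁ ; connects = λ { (hereₗ refl) e∈Y → contradiction e∈Y e∉Y } }
    ... | yes e∈Y with reach? s (proj₁ (ends e∈Y)) (proj₂ (ends e∈Y))
    ...   | yes linked = record { result = s ; extends = id ; within = inj₁ ; connects = λ { (hereₗ refl) _ → linked } }
    ...   | no unlinked = record
      { result   = insertEdge s (proj₁ (ends e∈Y)) (proj₂ (ends e∈Y)) unlinked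
      ; extends  = p⊆p∪q ⁅ e ⁆
      ; within   = Sum.map₂ (λ x∈⁅e⁆ → subst (_∈ Y) (sym (x∈⁅y⁆⇒x≡y e x∈⁅e⁆)) e∈Y) ∘ x∈p∪q⁻ (edges s) ⁅ e ⁆
      ; connects = λ { (hereₗ refl) _ → reach-edge (q⊆p∪q (edges s) ⁅ e ⁆ (x∈⁅x⁆ e)) (inj₁ (refl , refl)) }
      }

    extend-∷ : ∀ {S Y e L} {s : KruskalState S} (r : Extension s Y (e ∷ [])) → Extension (result r) Y L → Extension s Y (e ∷ L)
    extend-∷ r r' = record
      { result   = result r'
      ; extends  = extends r' ∘ extends r
      ; within   = [ within r , inj₂ ]′ ∘ within r'
      ; connects = λ { (hereₗ refl) e∈Y → reach-mono (extends r') (connects r (hereₗ refl) e∈Y)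
                     ; (thereₗ e∈L) e∈Y → connects r' e∈L e∈Y }
      }

    extend : ∀ {S Y} → EndsIn G S Y → (s : KruskalState S) (L : List (Fin m)) → Extension s Y L
    extend ends s []      = record { result = s ; extends = id ; within = inj₁ ; connects = λ () }
    extend ends s (e ∷ L) = extend-∷ r (extend ends (result r) L)
      where r = extendByEdge ends s e

    spanning : ∀ {S Y} → EndsIn G S Y → (s : KruskalState S) → Extension s Y (allFin m)
    spanning ends s = extend ends s (allFin m)

    spanning-connects : ∀ {S Y} {s : KruskalState S} (r : Extension s Y (allFin m)) →
                        ∀ {e} → e ∈ Y → Reach G (edges (result r)) (src e) (tgt e)
    spanning-connects r = connects r (∈-allFin _)

    module _ {S Y} (ends : EndsIn G S Y) where
      private
        r = spanning ends (initialState S)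
        T = edges (result r)

      spanningForest⊆ : T ⊆ Y
      spanningForest⊆ e∈T with within r e∈T
      ... | inj₁ e∈⊥ = contradiction e∈⊥ ∉⊥
      ... | inj₂ e∈Y = e∈Y

      vertices≤edges+components : ∀ {c} → Components G S Y c → ∣ S ∣ ≤ ∣ Y ∣ + c
      vertices≤edges+components ωY = begin
        ∣ S ∣                                  ≡⟨ sym (size (result r)) ⟩
        ∣ T ∣ + #components (result r)        ≤⟨ +-mono-≤ (p⊆q⇒∣p∣≤∣q∣ spanningForest⊆)
                                                          (components-≤ (components (result r)) ωY (reach-lift (spanning-connects r))) ⟩
        ∣ Y ∣ + _                              ∎
        where open ≤-Reasoning

      -- Kruskal's algorithm run on a forest keeps every edge.
      edges+components≤vertices : Forest G Y → ∀ {Y' c} → Components G S Y' c →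
                                  (∀ {u v} → Reach G Y u v → Reach G Y' u v) → ∣ Y ∣ + c ≤ ∣ S ∣
      edges+components≤vertices forest ωY' Y⇒Y' = begin
        ∣ Y ∣ + _                         ≤⟨ +-mono-≤ (p⊆q⇒∣p∣≤∣q∣ Y⊆T)
                                                      (components-≤ ωY' (components (result r)) (Y⇒Y' ∘ reach-mono spanningForest⊆)) ⟩
        ∣ T ∣ + #components (result r)  ≡⟨ size (result r) ⟩
        ∣ S ∣                             ∎
        where
        open ≤-Reasoning
        Y⊆T : Y ⊆ T
        Y⊆T {x} x∈Y with x ∈? T
        ... | yes x∈T = x∈T
        ... | no  x∉T = contradiction (reach-mono T⊆Y-x (spanning-connects r x∈Y)) (forest x x∈Y)
          where
          T⊆Y-x : T ⊆ Y - x
          T⊆Y-x t∈T = x∈p∧x≢y⇒x∈p-y (spanningForest⊆ t∈T) (λ { refl → x∉T t∈T })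

    -- An edge on a cycle could be deleted without changing the components, which would
    -- contradict vertices≤edges+components for the smaller edge set.
    kruskalState-forest : ∀ {S} (s : KruskalState S) → Forest G (edges s)
    kruskalState-forest {S} s e e∈T linked = <-irrefl refl (begin-strict
      ∣ S ∣                          ≤⟨ vertices≤edges+components ends-e components-e ⟩
      ∣ T - e ∣ + #components s     <⟨ +-monoˡ-< (#components s) (x∈p⇒∣p-x∣<∣p∣ e∈T) ⟩
      ∣ T ∣ + #components s         ≡⟨ size s ⟩
      ∣ S ∣                          ∎)
      where
      open ≤-Reasoning
      T = edges s
      ends-e : EndsIn G S (T - e)
      ends-e = edges-within s ∘ p─q⊆p T ⁅ e ⁆
      bypass : ∀ {x} → x ∈ T → Reach G (T - e) (src x) (tgt x)
      bypass {x} x∈T with x ≟ e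
      ... | yes refl = linked
      ... | no  x≢e  = reach-edge (x∈p∧x≢y⇒x∈p-y x∈T x≢e) (inj₁ (refl , refl))
      components-e : Components G S (T - e) (#components s)
      components-e = components-cong (reach-lift bypass) (reach-mono (p─q⊆p T ⁅ e ⁆)) (components s)

    forest-edges+components≡vertices : ∀ {S F c} → Forest G F → EndsIn G S F → Components G S F c → ∣ F ∣ + c ≡ ∣ S ∣
    forest-edges+components≡vertices forest ends ωF =
      ≤-antisym (edges+components≤vertices ends forest ωF id) (vertices≤edges+components ends ωF)

  -- Connected graphs

  module _ {G : Graph} (connected : Connected G) where
    open Graph G
    open KruskalState
    open Extension

    private
      vertex : Fin n
      vertex = fromℕ< (>-nonZero⁻¹ n {{proj₁ connected}})

      endsIn-⊤ : ∀ {Y} → EndsIn G ⊤ Y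
      endsIn-⊤ _ = ∈⊤ , ∈⊤

    components-connected : ∀ {Y} → (∀ u v → Reach G Y u v) → Components G ⊤ Y 1
    components-connected linked =
      (λ _ _ → zero) , (λ u v _ _ → mk⇔ (λ _ → linked u v) (λ _ → refl)) , λ { zero → vertex , ∈⊤ , refl }

    forest-size : ∀ {F} → Forest G F → ∣ F ∣ + 1 ≤ n
    forest-size {F} forest = subst (∣ F ∣ + 1 ≤_) (∣⊤∣≡n n)
      (edges+components≤vertices endsIn-⊤ forest (components-connected (proj₂ connected)) (reach-mono λ _ → ∈⊤))

    spanning-size : ∀ {T} → (∀ u v → Reach G T u v) → n ≤ ∣ T ∣ + 1
    spanning-size {T} linked =
      subst (_≤ ∣ T ∣ + 1) (∣⊤∣≡n n) (vertices≤edges+components endsIn-⊤ (components-connected linked))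

    -- Running Kruskal's algorithm on Y before the other edges makes T ∩ Y a spanning forest of Y.
    spanningTree : ∀ Y → Σ (ESet G) λ T → Forest G T × (∀ u v → Reach G T u v)
                                       × (∀ {e} → e ∈ Y → Reach G (T ∩ Y) (src e) (tgt e))
    spanningTree Y = edges (result r₂) , kruskalState-forest (result r₂) , linked , linked-in-Y
      where
      r₁ = spanning {G = G} {Y = Y} endsIn-⊤ (initialState ⊤)
      r₂ = spanning {G = G} {Y = ⊤} endsIn-⊤ (result r₁)
      linked : ∀ u v → Reach G (edges (result r₂)) u v
      linked u v = reach-lift (λ _ → spanning-connects r₂ ∈⊤) (proj₂ connected u v)
      linked-in-Y : ∀ {e} → e ∈ Y → Reach G (edges (result r₂) ∩ Y) (src e) (tgt e)
      linked-in-Y = reach-mono (λ x∈ → x∈p∩q⁺ (extends r₂ x∈ , spanningForest⊆ endsIn-⊤ x∈)) ∘ spanning-connects r₁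

    spanningTree-isBasis : ∀ {T} → Forest G T → (∀ u v → Reach G T u v) → IsBasis G T
    spanningTree-isBasis forest linked =
      forest , λ F F-forest → +-cancelʳ-≤ 1 _ _ (≤-trans (forest-size F-forest) (spanning-size linked))

    basis-size : ∀ {B} → IsBasis G B → ∣ B ∣ + 1 ≡ n
    basis-size {B} (forest , maximal) with spanningTree ⊥
    ... | T , T-forest , linked , _ =
      ≤-antisym (forest-size forest) (≤-trans (spanning-size linked) (+-monoˡ-≤ 1 (maximal T T-forest)))

  -- Degrees and cuts

  module _ {G : Graph} where
    open Graph G

    induced-∁≡∁-δ : ∀ A → induced G (∁ A) ≡ ∁ (δ G A)
    induced-∁≡∁-δ A = begin
      tabulate (λ e → lookup (∁ A) (src e) ∧ lookup (∁ A) (tgt e))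
        ≡⟨ tabulate-cong (λ e → trans (cong₂ _∧_ (lookup-map (src e) not A) (lookup-map (tgt e) not A))
                                      (sym (not-∨ (lookup A (src e)) (lookup A (tgt e))))) ⟩
      tabulate (not ∘ λ e → lookup A (src e) ∨ lookup A (tgt e))
        ≡⟨ tabulate-∘ not _ ⟩
      ∁ (δ G A)  ∎
      where open ≡-Reasoning

    handshake : ∀ A → ∣ δ G A ∣ + ∣ induced G A ∣ ≡ ∑[ v < n ] (𝟙 (lookup A v) * degree G v)
    handshake A = begin
      ∣ δ G A ∣ + ∣ induced G A ∣
        ≡⟨ cong₂ _+_ (∣tabulate∣≡count (λ e → a (src e) ∨ a (tgt e)))
                     (∣tabulate∣≡count (λ e → a (src e) ∧ a (tgt e))) ⟩
      count (λ e → a (src e) ∨ a (tgt e)) + count (λ e → a (src e) ∧ a (tgt e))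
        ≡⟨ count-∨+count-∧ (a ∘ src) (a ∘ tgt) ⟩
      count (a ∘ src) + count (a ∘ tgt)
        ≡⟨ cong₂ _+_ (count-∘≡∑-fibres src a) (count-∘≡∑-fibres tgt a) ⟩
      ∑[ v < n ] (𝟙 (a v) * srcDeg v) + ∑[ v < n ] (𝟙 (a v) * tgtDeg v)
        ≡⟨ sym (∑-distrib-+ (λ v → 𝟙 (a v) * srcDeg v) (λ v → 𝟙 (a v) * tgtDeg v)) ⟩
      ∑[ v < n ] (𝟙 (a v) * srcDeg v + 𝟙 (a v) * tgtDeg v)
        ≡⟨ sum-cong-≗ (λ v → trans (sym (*-distribˡ-+ (𝟙 (a v)) (srcDeg v) (tgtDeg v)))
                                    (cong (𝟙 (a v) *_) (sym (degree≡ v)))) ⟩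
      ∑[ v < n ] (𝟙 (a v) * degree G v)  ∎
      where
      open ≡-Reasoning
      a = lookup A
      srcDeg tgtDeg : Fin n → ℕ
      srcDeg v = count (λ e → ⌊ src e ≟ v ⌋)
      tgtDeg v = count (λ e → ⌊ tgt e ≟ v ⌋)
      degree≡ : ∀ v → degree G v ≡ srcDeg v + tgtDeg v
      degree≡ v = cong₂ _+_ (∣tabulate∣≡count (λ e → ⌊ src e ≟ v ⌋)) (∣tabulate∣≡count (λ e → ⌊ tgt e ≟ v ⌋))

    handshake-trivalent : Trivalent G → ∀ A → ∣ δ G A ∣ + ∣ induced G A ∣ ≡ ∣ A ∣ * 3
    handshake-trivalent trivalent A = begin
      ∣ δ G A ∣ + ∣ induced G A ∣               ≡⟨ handshake A ⟩
      ∑[ v < n ] (𝟙 (lookup A v) * degree G v)  ≡⟨ sum-cong-≗ (λ v → cong (𝟙 (lookup A v) *_) (trivalent v)) ⟩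
      ∑[ v < n ] (𝟙 (lookup A v) * 3)           ≡⟨ sym (*-distribʳ-sum 3 (𝟙 ∘ lookup A)) ⟩
      count (lookup A) * 3                      ≡⟨ cong (_* 3) (sym (∣p∣≡count A)) ⟩
      ∣ A ∣ * 3                                  ∎
      where open ≡-Reasoning

  module _ {G : Graph} (connected : Connected G) (A : VSet G) {c} (ωc : ComponentCount G (∁ A) c) where
    open Graph G

    private
      X = δ G A
      N = ∣ ∁ A ∣

      ωXᶜ : Components G (∁ A) (∁ X) c
      ωXᶜ = subst (λ Z → Components G (∁ A) Z c) (induced-∁≡∁-δ A) ωc

      endsIn-Xᶜ : EndsIn G (∁ A) (∁ X)
      endsIn-Xᶜ = ∈-induced⁻ ∘ subst (_ ∈_) (sym (induced-∁≡∁-δ A))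

    forest∩Xᶜ-size : ∀ {F} → Forest G F → ∣ F ∩ ∁ X ∣ + c ≤ N
    forest∩Xᶜ-size {F} forest = edges+components≤vertices (endsIn-Xᶜ ∘ p∩q⊆q F (∁ X)) (forest-⊆ (p∩q⊆p F (∁ X)) forest)
                                                         ωXᶜ (reach-mono (p∩q⊆q F (∁ X)))

    -- r*(δ A) = |δ A| - r(E) + r(E - δ A) without subtraction, for any basis B; the slack
    -- N - (|B ∩ ∁ X| + c) vanishes exactly when B ∩ ∁ X is a spanning forest of ∁ X.
    basis-balance : ∀ {B} → ∣ B ∣ + 1 ≡ n → ∣ X ∩ ∁ B ∣ + (∣ A ∣ + c) + N ≡ ∣ X ∣ + 1 + (∣ B ∩ ∁ X ∣ + c)
    basis-balance {B} ∣B∣+1≡n = begin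
      ∣ X ∩ ∁ B ∣ + (∣ A ∣ + c) + N
        ≡⟨ rearrange₁ (∣ X ∩ ∁ B ∣) (∣ A ∣) c N ⟩
      ∣ X ∩ ∁ B ∣ + c + (∣ A ∣ + N)
        ≡⟨ cong (∣ X ∩ ∁ B ∣ + c +_) (trans (∣p∣+∣∁p∣≡n A) (sym ∣B∣+1≡n)) ⟩
      ∣ X ∩ ∁ B ∣ + c + (∣ B ∣ + 1)
        ≡⟨ cong (λ b → ∣ X ∩ ∁ B ∣ + c + (b + 1)) split-B ⟩
      ∣ X ∩ ∁ B ∣ + c + (∣ X ∩ B ∣ + ∣ B ∩ ∁ X ∣ + 1)
        ≡⟨ rearrange₂ (∣ X ∩ ∁ B ∣) c (∣ X ∩ B ∣) (∣ B ∩ ∁ X ∣) ⟩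
      ∣ X ∩ B ∣ + ∣ X ∩ ∁ B ∣ + 1 + (∣ B ∩ ∁ X ∣ + c)
        ≡⟨ cong (λ x → x + 1 + (∣ B ∩ ∁ X ∣ + c)) (sym (∣p∣≡∣p∩q∣+∣p∩∁q∣ X B)) ⟩
      ∣ X ∣ + 1 + (∣ B ∩ ∁ X ∣ + c)  ∎
      where
      open ≡-Reasoning
      split-B : ∣ B ∣ ≡ ∣ X ∩ B ∣ + ∣ B ∩ ∁ X ∣
      split-B = trans (∣p∣≡∣p∩q∣+∣p∩∁q∣ B X) (cong (λ Y → ∣ Y ∣ + ∣ B ∩ ∁ X ∣) (∩-comm B X))
      rearrange₁ : ∀ x a c N → x + (a + c) + N ≡ x + c + (a + N)
      rearrange₁ = solve-∀
      rearrange₂ : ∀ x c y z → x + c + (y + z + 1) ≡ y + x + 1 + (z + c)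
      rearrange₂ = solve-∀

    corank-δ-≤ : ∀ {k} → CoRank G X k → k + (∣ A ∣ + c) ≤ ∣ X ∣ + 1
    corank-δ-≤ {k} ((I , I⊆X , (B , B-basis , B⊆∁I) , ∣I∣≡k) , _) = +-cancelʳ-≤ N _ _ (begin
      k + (∣ A ∣ + c) + N               ≤⟨ +-monoˡ-≤ N (+-monoˡ-≤ (∣ A ∣ + c) k≤∣X∩∁B∣) ⟩
      ∣ X ∩ ∁ B ∣ + (∣ A ∣ + c) + N     ≡⟨ basis-balance (basis-size connected B-basis) ⟩
      ∣ X ∣ + 1 + (∣ B ∩ ∁ X ∣ + c)     ≤⟨ +-monoʳ-≤ (∣ X ∣ + 1) (forest∩Xᶜ-size (proj₁ B-basis)) ⟩
      ∣ X ∣ + 1 + N                     ∎)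
      where
      open ≤-Reasoning
      I⊆X∩∁B : I ⊆ X ∩ ∁ B
      I⊆X∩∁B x∈I = x∈p∩q⁺ (I⊆X x∈I , x∉p⇒x∈∁p (λ x∈B → x∈p⇒x∉∁p x∈I (B⊆∁I x∈B)))
      k≤∣X∩∁B∣ : k ≤ ∣ X ∩ ∁ B ∣
      k≤∣X∩∁B∣ = subst (_≤ ∣ X ∩ ∁ B ∣) ∣I∣≡k (p⊆q⇒∣p∣≤∣q∣ I⊆X∩∁B)

    corank-δ-≥ : ∀ {k} → CoRank G X k → ∣ X ∣ + 1 ≤ k + (∣ A ∣ + c)
    corank-δ-≥ {k} (_ , maximal) with spanningTree connected (∁ X)
    ... | T , forest , linked , linked-in-Xᶜ = +-cancelʳ-≤ N _ _ (begin
      ∣ X ∣ + 1 + N                     ≤⟨ +-monoʳ-≤ (∣ X ∣ + 1) N≤∣T∩∁X∣+c ⟩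
      ∣ X ∣ + 1 + (∣ T ∩ ∁ X ∣ + c)     ≡⟨ sym (basis-balance (basis-size connected T-basis)) ⟩
      ∣ X ∩ ∁ T ∣ + (∣ A ∣ + c) + N     ≤⟨ +-monoˡ-≤ N (+-monoˡ-≤ (∣ A ∣ + c) ∣X∩∁T∣≤k) ⟩
      k + (∣ A ∣ + c) + N               ∎)
      where
      open ≤-Reasoning
      T-basis = spanningTree-isBasis connected forest linked
      N≤∣T∩∁X∣+c : N ≤ ∣ T ∩ ∁ X ∣ + c
      N≤∣T∩∁X∣+c = vertices≤edges+components (endsIn-Xᶜ ∘ p∩q⊆q T (∁ X))
                     (components-cong (reach-lift linked-in-Xᶜ) (reach-mono (p∩q⊆q T (∁ X))) ωXᶜ)
      T⊆∁[X∩∁T] : T ⊆ ∁ (X ∩ ∁ T)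
      T⊆∁[X∩∁T] x∈T = x∉p⇒x∈∁p (λ x∈ → x∈p⇒x∉∁p x∈T (proj₂ (x∈p∩q⁻ X (∁ T) x∈)))
      ∣X∩∁T∣≤k : ∣ X ∩ ∁ T ∣ ≤ k
      ∣X∩∁T∣≤k = maximal (X ∩ ∁ T) (p∩q⊆p X (∁ T)) (T , T-basis , T⊆∁[X∩∁T])

    corank-δ : ∀ {k} → CoRank G X k → k + (∣ A ∣ + c) ≡ ∣ X ∣ + 1
    corank-δ corank = ≤-antisym (corank-δ-≤ corank) (corank-δ-≥ corank)

  corank-δ-acyclic : ∀ {G} → Trivalent G → Connected G → ∀ A {c k a} → ComponentCount G (∁ A) c →
                     CoRank G (δ G A) k → AcyclicV G A → ComponentCount G A a → k + c ≡ ∣ A ∣ + a + 1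
  corank-δ-acyclic {G} trivalent connected A {c} {k} {a} ωc corank acyclic ωA =
    +-cancelʳ-≡ (∣ A ∣ + ι) (k + c) (∣ A ∣ + a + 1) (begin
      k + c + (∣ A ∣ + ι)       ≡⟨ rearrange₁ k c (∣ A ∣) ι ⟩
      k + (∣ A ∣ + c) + ι       ≡⟨ cong (_+ ι) (corank-δ connected A ωc corank) ⟩
      x + 1 + ι                 ≡⟨ rearrange₂ x ι ⟩
      x + ι + 1                 ≡⟨ cong (_+ 1) (handshake-trivalent {G = G} trivalent A) ⟩
      ∣ A ∣ * 3 + 1             ≡⟨ rearrange₃ (∣ A ∣) ⟩
      ∣ A ∣ + ∣ A ∣ + 1 + ∣ A ∣  ≡⟨ cong (λ t → ∣ A ∣ + t + 1 + ∣ A ∣) (sym ι+a≡∣A∣) ⟩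
      ∣ A ∣ + (ι + a) + 1 + ∣ A ∣ ≡⟨ rearrange₄ (∣ A ∣) ι a ⟩
      ∣ A ∣ + a + 1 + (∣ A ∣ + ι) ∎)
    where
    open ≡-Reasoning
    x = ∣ δ G A ∣
    ι = ∣ induced G A ∣
    ι+a≡∣A∣ : ι + a ≡ ∣ A ∣
    ι+a≡∣A∣ = forest-edges+components≡vertices acyclic ∈-induced⁻ ωA
    rearrange₁ : ∀ k c A ι → k + c + (A + ι) ≡ k + (A + c) + ι
    rearrange₁ = solve-∀
    rearrange₂ : ∀ x ι → x + 1 + ι ≡ x + ι + 1
    rearrange₂ = solve-∀
    rearrange₃ : ∀ A → A * 3 + 1 ≡ A + A + 1 + A
    rearrange₃ = solve-∀
    rearrange₄ : ∀ A ι a → A + (ι + a) + 1 + A ≡ A + a + 1 + (A + ι)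
    rearrange₄ = solve-∀

open import Data.Nat using (ℕ)
open import Data.Integer using (ℤ; +_; _+_; _-_)
open import Data.Fin.Subset using (∣_∣; ∁)
open import Data.Product using (_×_; _,_)
open import Relation.Binary.PropositionalEquality using (_≡_; refl; cong; cong₂; trans; sym; module ≡-Reasoning)
import Data.Nat as ℕ
open import Data.Integer.Properties using (pos-+)
open import Data.Integer.Tactic.RingSolver using (solve-∀)
open CographicRankOfCuts using (corank-δ; corank-δ-acyclic)

k+s≡t⇒+k≡+t-+s : ∀ {k s t} → k ℕ.+ s ≡ t → + k ≡ + t - + s
k+s≡t⇒+k≡+t-+s {k} {s} refl = begin
  + k                ≡⟨ cancel (+ k) (+ s) ⟩
  + k + + s - + s    ≡⟨ cong (_- + s) (sym (pos-+ k s)) ⟩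
  + (k ℕ.+ s) - + s  ∎
  where
  open ≡-Reasoning
  cancel : ∀ (k s : ℤ) → k ≡ k + s - s
  cancel = solve-∀

k+[a+c]≡x+1⇒+k≡+x-+a-+c+1 : ∀ {k a c x} → k ℕ.+ (a ℕ.+ c) ≡ x ℕ.+ 1 → + k ≡ + x - + a - + c + + 1
k+[a+c]≡x+1⇒+k≡+x-+a-+c+1 {k} {a} {c} {x} eq = begin
  + k                          ≡⟨ k+s≡t⇒+k≡+t-+s eq ⟩
  + (x ℕ.+ 1) - + (a ℕ.+ c)    ≡⟨ cong₂ _-_ (pos-+ x 1) (pos-+ a c) ⟩
  (+ x + + 1) - (+ a + + c)    ≡⟨ rearrange (+ x) (+ a) (+ c) ⟩
  + x - + a - + c + + 1        ∎
  where
  open ≡-Reasoning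
  rearrange : ∀ (x a c : ℤ) → (x + + 1) - (a + c) ≡ x - a - c + + 1
  rearrange = solve-∀

k+c≡a+w+1⇒+k≡+a++w-+c+1 : ∀ {k c a w} → k ℕ.+ c ≡ a ℕ.+ w ℕ.+ 1 → + k ≡ + a + + w - + c + + 1
k+c≡a+w+1⇒+k≡+a++w-+c+1 {k} {c} {a} {w} eq = begin
  + k                        ≡⟨ k+s≡t⇒+k≡+t-+s eq ⟩
  + (a ℕ.+ w ℕ.+ 1) - + c    ≡⟨ cong (_- + c) (trans (pos-+ (a ℕ.+ w) 1) (cong (_+ + 1) (pos-+ a w))) ⟩
  (+ a + + w + + 1) - + c    ≡⟨ rearrange (+ a) (+ w) (+ c) ⟩
  + a + + w - + c + + 1      ∎
  where
  open ≡-Reasoning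
  rearrange : ∀ (a w c : ℤ) → (a + w + + 1) - c ≡ a + w - c + + 1
  rearrange = solve-∀

lemma3p2 : (G : Graph) → Trivalent G → TwoEdgeConnected G →
    (A : VSet G) → (k c : ℕ) → CoRank G (δ G A) k → ComponentCount G (∁ A) c →
      ((+ k) ≡ (+ ∣ δ G A ∣) - (+ ∣ A ∣) - (+ c) + (+ 1))
      × ((a : ℕ) → AcyclicV G A → ComponentCount G A a →
           (+ k) ≡ (+ ∣ A ∣) + (+ a) - (+ c) + (+ 1))
lemma3p2 G trivalent (connected , _) A k c corank ωc =
    k+[a+c]≡x+1⇒+k≡+x-+a-+c+1 {a = ∣ A ∣} {c} (corank-δ {G = G} connected A ωc corank)
  , λ a acyclic ωA → k+c≡a+w+1⇒+k≡+a++w-+c+1 {c = c} {∣ A ∣} {a}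
                         (corank-δ-acyclic {G} trivalent connected A ωc corank acyclic ωA)
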